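{- Let $G\cong\mathbb{Z}_2^r$, of order $v=2^r$, and let $J$ be a proper subgroup of $G$ with $J\cong\mathbb{Z}_2^{r_1}$, of order $t=2^{r_1}$. Let $\lambda,n$ be positive integers. Then there exists a ${}^\lambda\mathrm{NH}_t(1,n)$ over $G$ relative to $J$ if and only if $v=\frac{2n}{\lambda}+t$, $\lambda$ is even, and one of the following holds: (1) $t=2$ (i.e. $r_1=1$) and $n$ is an odd multiple of $v-t$; (2) $v=2$ (i.e. $r=1$, $r_1=0$) and $n$ is odd.
   Context: Groups are written additively. An $m\times n$ partially filled (p.f.) array over $G$ is an $m\times n$ matrix each of whose cells is empty or contains an element of $G$. For a subgroup $J$ of order $t$, a ${}^\lambda\mathrm{NH}_t(m,n;h,k)$ over $G$ relative to $J$ is an $m\times n$ p.f. array $A$ over $G$ such that: (a) each row contains exactly $h$ filled cells and each column exactly $k$ filled cells; (b) the multiset obtained by taking, for every filled cell with entry $x$, both $x$ and $-x$ (with multiplicity, so an involution contributes twice), is exactly the multiset containing each element of $G\setminus J$ exactly $\lambda$ times; (c) each row sum (left to right) and each column sum (top to bottom) is nonzero. ${}^\lambda\mathrm{NH}_t(1,n)$ denotes ${}^\lambda\mathrm{NH}_t(1,n;n,1)$ (a single fully filled row). -}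

module Defs where

open import Data.Nat using (ℕ; zero; suc; _+_; _*_)
open import Data.Bool using (Bool; true; false; _xor_)
open import Data.Bool.Properties using () renaming (_≟_ to _≟B_)
open import Data.Vec using (Vec; []; _∷_; map; zipWith; replicate; foldr; count)
open import Data.Vec.Properties using (≡-dec)
open import Data.Product using (Σ; ∃; _×_)
open import Relation.Binary.PropositionalEquality using (_≡_)
open import Relation.Nullary using (¬_; Dec)
open import Function.Definitions using (Injective)

G : ℕ → Set
G r = Vec Bool r

_⊕_ : ∀ {r} → G r → G r → G r
_⊕_ = zipWith _xor_

𝟘 : ∀ {r} → G r
𝟘 = replicate _ false

-- additive inverse in Z_2 (every element is its own inverse)
negB : Bool → Bool
negB b = b

⊖_ : ∀ {r} → G r → G r
⊖_ = map negB

_≟G_ : ∀ {r} (x y : G r) → Dec (x ≡ y)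
_≟G_ = ≡-dec _≟B_

-- An embedding of Z_2^{r1} into Z_2^r as a group: an injective homomorphism.
-- Its image is a subgroup J ≅ Z_2^{r1} of order 2^{r1}.
record Embedding (r₁ r : ℕ) : Set where
  field
    φ     : G r₁ → G r
    hom   : ∀ x y → φ (x ⊕ y) ≡ φ x ⊕ φ y
    inj   : Injective _≡_ _≡_ φ

_∈J_ : ∀ {r₁ r} → G r → Embedding r₁ r → Set
g ∈J E = ∃ λ y → Embedding.φ E y ≡ g

Proper : ∀ {r₁ r} → Embedding r₁ r → Set
Proper {r = r} E = Σ (G r) λ g → ¬ (g ∈J E)

-- multiplicity of g in the multiset { a_i, -a_i : i } (each cell contributes x and -x)
mult : ∀ {r n} → G r → Vec (G r) n → ℕ
mult g a = count (_≟G g) a + count (_≟G g) (map ⊖_ a)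

rowSum : ∀ {r n} → Vec (G r) n → G r
rowSum = foldr _ _⊕_ 𝟘

-- A ^λNH_t(1,n) = ^λNH_t(1,n;n,1) over G = Z_2^r relative to J (the image of E):
-- a single fully filled row of n cells (so each row has n filled cells and each
-- of the n columns has exactly one filled cell).
record NH1 (λ' : ℕ) {r₁ r : ℕ} (E : Embedding r₁ r) (n : ℕ) : Set where
  field
    row      : Vec (G r) n
    multJ    : ∀ g → g ∈J E → mult g row ≡ 0
    multOut  : ∀ g → ¬ (g ∈J E) → mult g row ≡ λ'
    -- (c): row sum nonzero, and every column sum (= its single entry) nonzero
    rowNZ    : ¬ (rowSum row ≡ 𝟘)
    colNZ    : ∀ i → ¬ (Data.Vec.lookup row i ≡ 𝟘)

module Submission where

-- Every element of Z₂^r is its own negative, so condition (b) says that the row contains each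
-- g ∉ J exactly h = λ/2 times and no element of J; conversely such a multiset can always be
-- listed as a row. Hence n = h(2^r − 2^r₁), and the row sum is h·T with T the sum of G ∖ J.
-- Now h·T is T for odd h and 0 for even h, while T = ΣG − ΣJ and the sum of all of Z₂^k
-- vanishes unless k = 1. So the row sum is nonzero iff h is odd and exactly one of r, r₁ is 1,
-- giving the two cases of the theorem.

open import Defs
open import Level using (0ℓ)
open import Algebra.Bundles using (CommutativeMonoid)
open import Algebra.Core using (Op₂)
open import Algebra.Structures using (IsCommutativeMonoid)
open import Data.Bool using (true; false; if_then_else_)
open import Data.Bool.Properties using (xor-assoc; xor-comm; xor-identityˡ; xor-identityʳ; xor-same)
open import Data.Empty using (⊥-elim)
open import Data.Nat using (ℕ; zero; suc; _+_; _*_; _^_; _∸_; _≤_; z≤n; s≤s; NonZero; ≢-nonZero; ≢-nonZero⁻¹)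
open import Data.Nat.Divisibility using (_∣_; divides)
open import Data.Nat.Properties
open import Data.Product using (∃; _×_; _,_; proj₁; proj₂)
open import Data.Sum using (_⊎_; inj₁; inj₂)
open import Data.Vec using (Vec; []; _∷_; map; replicate; count; lookup; foldr; _++_)
open import Data.Vec.Properties using (zipWith-assoc; zipWith-comm; zipWith-identityˡ; zipWith-identityʳ; map-id; map-cong)
open import Data.Fin as Fin using (Fin)
open import Function using (_∘_; id; _⇔_; mk⇔; Equivalence)
open import Relation.Binary.PropositionalEquality
open import Relation.Binary.PropositionalEquality.Algebra using (isMagma)
open import Relation.Nullary using (Dec; yes; no; does; ¬_)
open import Function.Definitions using (Injective)
open import Relation.Nullary.Decidable using (map′; _⊎-dec_)

cubeSum : {M : Set} → Op₂ M → ∀ k → (G k → M) → M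
cubeSum _∙_ zero    f = f []
cubeSum _∙_ (suc k) f = cubeSum _∙_ k (f ∘ (true ∷_)) ∙ cubeSum _∙_ k (f ∘ (false ∷_))

cubeSum-cong : ∀ {M} (_∙_ : Op₂ M) k {f g : G k → M} → (∀ x → f x ≡ g x) → cubeSum _∙_ k f ≡ cubeSum _∙_ k g
cubeSum-cong _∙_ zero    f≗g = f≗g []
cubeSum-cong _∙_ (suc k) f≗g =
  cong₂ _∙_ (cubeSum-cong _∙_ k (f≗g ∘ (true ∷_))) (cubeSum-cong _∙_ k (f≗g ∘ (false ∷_)))

cubeSum-homo : ∀ {M N} {_∙_ : Op₂ M} {_◦_ : Op₂ N} (ψ : M → N) → (∀ a b → ψ (a ∙ b) ≡ ψ a ◦ ψ b) →
               ∀ k (f : G k → M) → ψ (cubeSum _∙_ k f) ≡ cubeSum _◦_ k (ψ ∘ f)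
cubeSum-homo ψ homo zero    f = refl
cubeSum-homo {_◦_ = _◦_} ψ homo (suc k) f =
  trans (homo _ _) (cong₂ _◦_ (cubeSum-homo ψ homo k _) (cubeSum-homo ψ homo k _))

∃?-cube : ∀ k {P : G k → Set} → (∀ g → Dec (P g)) → Dec (∃ P)
∃?-cube zero    P? = map′ ([] ,_) (λ { ([] , p) → p }) (P? [])
∃?-cube (suc k) {P} P? = map′ join split (∃?-cube k (P? ∘ (true ∷_)) ⊎-dec ∃?-cube k (P? ∘ (false ∷_)))
  where
  join : ∃ (P ∘ (true ∷_)) ⊎ ∃ (P ∘ (false ∷_)) → ∃ P
  join (inj₁ (g , p)) = true ∷ g , p
  join (inj₂ (g , p)) = false ∷ g , p
  split : ∃ P → ∃ (P ∘ (true ∷_)) ⊎ ∃ (P ∘ (false ∷_))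
  split (true ∷ g , p)  = inj₁ (g , p)
  split (false ∷ g , p) = inj₂ (g , p)

module CubeSum {M : Set} {_∙_ : Op₂ M} {ε : M} (isCM : IsCommutativeMonoid _≡_ _∙_ ε) where

  open IsCommutativeMonoid isCM public using (assoc; identityˡ; identityʳ)

  commutativeMonoid : CommutativeMonoid 0ℓ 0ℓ
  commutativeMonoid = record { isCommutativeMonoid = isCM }

  open CommutativeMonoid commutativeMonoid using (commutativeSemigroup)
  open import Algebra.Properties.CommutativeSemigroup commutativeSemigroup using (interchange)
  open import Algebra.Properties.CommutativeMonoid.Mult commutativeMonoid public
    using () renaming (_×_ to _·_; ×-distrib-+ to ·-distrib-∙)

  ·-ε : ∀ n → n · ε ≡ ε
  ·-ε zero    = refl
  ·-ε (suc n) = trans (identityˡ _) (·-ε n)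

  ∑ : ∀ k → (G k → M) → M
  ∑ = cubeSum _∙_

  ∑-ε : ∀ k → ∑ k (λ _ → ε) ≡ ε
  ∑-ε zero    = refl
  ∑-ε (suc k) = trans (cong₂ _∙_ (∑-ε k) (∑-ε k)) (identityˡ ε)

  ∑-∙ : ∀ k (f g : G k → M) → ∑ k (λ x → f x ∙ g x) ≡ ∑ k f ∙ ∑ k g
  ∑-∙ zero    f g = refl
  ∑-∙ (suc k) f g = trans (cong₂ _∙_ (∑-∙ k _ _) (∑-∙ k _ _)) (interchange _ _ _ _)

  ∑-δ : ∀ k (x : G k) (F : G k → M) → ∑ k (λ g → if does (x ≟G g) then F g else ε) ≡ F x
  ∑-δ zero    []          F = refl
  ∑-δ (suc k) (true ∷ x)  F = trans (cong₂ _∙_ (∑-δ k x (F ∘ (true ∷_))) (∑-ε k)) (identityʳ _)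
  ∑-δ (suc k) (false ∷ x) F = trans (cong₂ _∙_ (∑-ε k) (∑-δ k x (F ∘ (false ∷_)))) (identityˡ _)

  ∑-swap : ∀ k l (F : G k → G l → M) → ∑ k (λ g → ∑ l (F g)) ≡ ∑ l (λ y → ∑ k (λ g → F g y))
  ∑-swap zero    l F = refl
  ∑-swap (suc k) l F = trans (cong₂ _∙_ (∑-swap k l _) (∑-swap k l _)) (sym (∑-∙ l _ _))

  count-∷-· : ∀ {k m} (x g : G k) (v : Vec (G k) m) (a : M) →
              count (_≟G g) (x ∷ v) · a ≡ (if does (x ≟G g) then a else ε) ∙ (count (_≟G g) v · a)
  count-∷-· x g v a with does (x ≟G g)
  ... | true  = refl
  ... | false = sym (identityˡ _)

  foldr-∑-count : ∀ {k m} (F : G k → M) (v : Vec (G k) m) →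
                  foldr _ (λ x acc → F x ∙ acc) ε v ≡ ∑ k (λ g → count (_≟G g) v · F g)
  foldr-∑-count {k} F [] = sym (∑-ε k)
  foldr-∑-count {k} F (x ∷ v) = begin
    F x ∙ foldr _ (λ x acc → F x ∙ acc) ε v
      ≡⟨ cong₂ _∙_ (sym (∑-δ k x F)) (foldr-∑-count F v) ⟩
    ∑ k (λ g → if does (x ≟G g) then F g else ε) ∙ ∑ k (λ g → count (_≟G g) v · F g)
      ≡⟨ sym (∑-∙ k _ _) ⟩
    ∑ k (λ g → (if does (x ≟G g) then F g else ε) ∙ (count (_≟G g) v · F g))
      ≡⟨ cubeSum-cong _∙_ k (λ g → sym (count-∷-· x g v (F g))) ⟩
    ∑ k (λ g → count (_≟G g) (x ∷ v) · F g) ∎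
    where open ≡-Reasoning

⊕-isCommutativeMonoid : ∀ r → IsCommutativeMonoid _≡_ (_⊕_ {r}) 𝟘
⊕-isCommutativeMonoid r = record
  { isMonoid = record
    { isSemigroup = record { isMagma = isMagma _⊕_ ; assoc = zipWith-assoc xor-assoc }
    ; identity    = zipWith-identityˡ xor-identityˡ , zipWith-identityʳ xor-identityʳ
    }
  ; comm = zipWith-comm xor-comm
  }

module ℕΣ = CubeSum +-0-isCommutativeMonoid
module GΣ {r} = CubeSum (⊕-isCommutativeMonoid r)
open GΣ using (_·_)

⊕-self : ∀ {r} (x : G r) → x ⊕ x ≡ 𝟘
⊕-self []      = refl
⊕-self (b ∷ x) = cong₂ _∷_ (xor-same b) (⊕-self x)

⊕-move : ∀ {r} (x y z : G r) → x ⊕ y ≡ z → x ≡ z ⊕ y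
⊕-move x y z x⊕y≡z = begin
  x             ≡⟨ sym (GΣ.identityʳ x) ⟩
  x ⊕ 𝟘         ≡⟨ cong (x ⊕_) (sym (⊕-self y)) ⟩
  x ⊕ (y ⊕ y)   ≡⟨ sym (GΣ.assoc x y y) ⟩
  (x ⊕ y) ⊕ y   ≡⟨ cong (_⊕ y) x⊕y≡z ⟩
  z ⊕ y         ∎
  where open ≡-Reasoning

ΣZ₂ : ∀ k → G k
ΣZ₂ k = cubeSum _⊕_ k id

ΣZ₂-≢1 : ∀ k → k ≢ 1 → ΣZ₂ k ≡ 𝟘
ΣZ₂-≢1 zero          _   = refl
ΣZ₂-≢1 (suc zero)    k≢1 = ⊥-elim (k≢1 refl)
ΣZ₂-≢1 (suc (suc j)) _   = begin
  ΣZ₂ (2 + j)                                     ≡⟨ sym (GΣ.∑-∙ (suc j) (true ∷_) (false ∷_)) ⟩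
  GΣ.∑ (suc j) (λ g → true ∷ (g ⊕ g))             ≡⟨ cubeSum-cong _⊕_ (suc j) (cong (true ∷_) ∘ ⊕-self) ⟩
  -- a constant sum over Z₂^(1+j) has the form s ⊕ s
  GΣ.∑ (suc j) (λ _ → true ∷ 𝟘)                   ≡⟨ ⊕-self _ ⟩
  𝟘                                               ∎
  where open ≡-Reasoning

ΣZ₂1≢𝟘 : ΣZ₂ 1 ≢ 𝟘
ΣZ₂1≢𝟘 ()

·-2+ : ∀ {r} h (x : G r) → (2 + h) · x ≡ h · x
·-2+ h x = begin
  x ⊕ (x ⊕ (h · x))   ≡⟨ sym (GΣ.assoc x x _) ⟩
  (x ⊕ x) ⊕ (h · x)   ≡⟨ cong (_⊕ (h · x)) (⊕-self x) ⟩
  𝟘 ⊕ (h · x)         ≡⟨ GΣ.identityˡ _ ⟩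
  h · x               ∎
  where open ≡-Reasoning

Odd : ℕ → Set
Odd h = ∃ λ k → h ≡ 2 * k + 1

2*suc+1 : ∀ k → 2 * suc k + 1 ≡ 2 + (2 * k + 1)
2*suc+1 k = cong suc (cong (_+ 1) (+-suc k (k + 0)))

2+-odd : ∀ {h} → Odd h → Odd (2 + h)
2+-odd (k , refl) = suc k , sym (2*suc+1 k)

·-odd : ∀ {r} h (x : G r) → Odd h → h · x ≡ x
·-odd .(2 * k + 1) x (k , refl) = go k
  where
  go : ∀ k → (2 * k + 1) · x ≡ x
  go zero    = GΣ.identityʳ x
  go (suc k) = trans (cong (_· x) (2*suc+1 k)) (trans (·-2+ (2 * k + 1) x) (go k))

·-≢𝟘⇒odd : ∀ {r} h (x : G r) → h · x ≢ 𝟘 → Odd h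
·-≢𝟘⇒odd zero          x h·x≢𝟘 = ⊥-elim (h·x≢𝟘 refl)
·-≢𝟘⇒odd (suc zero)    x _     = 0 , refl
·-≢𝟘⇒odd (suc (suc h)) x h·x≢𝟘 = 2+-odd (·-≢𝟘⇒odd h x (h·x≢𝟘 ∘ trans (·-2+ h x)))

·-≢𝟘⇔ : ∀ {r} h (x : G r) → (h · x ≢ 𝟘) ⇔ (Odd h × x ≢ 𝟘)
·-≢𝟘⇔ h x = mk⇔
  (λ h·x≢𝟘 → let odd = ·-≢𝟘⇒odd h x h·x≢𝟘 in odd , h·x≢𝟘 ∘ trans (·-odd h x odd))
  (λ (odd , x≢𝟘) → x≢𝟘 ∘ trans (sym (·-odd h x odd)))

≟G-injective-sym : ∀ {k l} {f : G k → G l} → Injective _≡_ _≡_ f →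
                   ∀ x y → does (f x ≟G f y) ≡ does (y ≟G x)
≟G-injective-sym {f = f} f-inj x y with f x ≟G f y | y ≟G x
... | yes _     | yes _    = refl
... | no _      | no _     = refl
... | yes fx≡fy | no y≢x   = ⊥-elim (y≢x (sym (f-inj fx≡fy)))
... | no fx≢fy  | yes refl = ⊥-elim (fx≢fy refl)

≟G-sym : ∀ {k} (x y : G k) → does (x ≟G y) ≡ does (y ≟G x)
≟G-sym = ≟G-injective-sym id

mult≡2*count : ∀ {r m} (g : G r) (v : Vec (G r) m) → mult g v ≡ 2 * count (_≟G g) v
mult≡2*count g v = begin
  count (_≟G g) v + count (_≟G g) (map ⊖_ v)
    ≡⟨ cong (λ w → count (_≟G g) v + count (_≟G g) w) (trans (map-cong map-id v) (map-id v)) ⟩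
  count (_≟G g) v + count (_≟G g) v
    ≡⟨ cong (count (_≟G g) v +_) (sym (+-identityʳ _)) ⟩
  2 * count (_≟G g) v ∎
  where open ≡-Reasoning

foldr-suc : ∀ {A : Set} {m} (v : Vec A m) → foldr _ (λ _ → suc) 0 v ≡ m
foldr-suc []      = refl
foldr-suc (_ ∷ v) = cong suc (foldr-suc v)

n·1≡n : ∀ n → n ℕΣ.· 1 ≡ n
n·1≡n zero    = refl
n·1≡n (suc n) = cong suc (n·1≡n n)

length-∑-count : ∀ {r m} (v : Vec (G r) m) → m ≡ ℕΣ.∑ r (λ g → count (_≟G g) v)
length-∑-count {r} v = begin
  _                                          ≡⟨ sym (foldr-suc v) ⟩
  foldr _ (λ _ → suc) 0 v                    ≡⟨ ℕΣ.foldr-∑-count (λ _ → 1) v ⟩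
  ℕΣ.∑ r (λ g → count (_≟G g) v ℕΣ.· 1)      ≡⟨ cubeSum-cong _+_ r (λ g → n·1≡n _) ⟩
  ℕΣ.∑ r (λ g → count (_≟G g) v)             ∎
  where open ≡-Reasoning

rowSum-∑-count : ∀ {r m} (v : Vec (G r) m) → rowSum v ≡ GΣ.∑ r (λ g → count (_≟G g) v · g)
rowSum-∑-count = GΣ.foldr-∑-count id

lookup-count≢0 : ∀ {r m} (v : Vec (G r) m) (i : Fin m) → count (_≟G lookup v i) v ≢ 0
lookup-count≢0 (x ∷ v) Fin.zero with x ≟G x
... | yes _   = λ ()
... | no x≢x  = ⊥-elim (x≢x refl)
lookup-count≢0 (x ∷ v) (Fin.suc i) with does (x ≟G lookup v i)
... | true  = λ ()
... | false = lookup-count≢0 v i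

count-++ : ∀ {r a b} (x : G r) (u : Vec (G r) a) (w : Vec (G r) b) →
           count (_≟G x) (u ++ w) ≡ count (_≟G x) u + count (_≟G x) w
count-++ x []      w = refl
count-++ x (y ∷ u) w with does (y ≟G x)
... | true  = cong suc (count-++ x u w)
... | false = count-++ x u w

count-replicate : ∀ {r} n (x g : G r) → count (_≟G x) (replicate n g) ≡ (if does (g ≟G x) then n else 0)
count-replicate zero    x g with does (g ≟G x)
... | true  = refl
... | false = refl
count-replicate (suc n) x g with does (g ≟G x) | count-replicate n x g
... | true  | ih = cong suc ih
... | false | ih = ih

_++ᵛ_ : ∀ {A : Set} → Op₂ (∃ (Vec A))
(m , u) ++ᵛ (n , w) = m + n , u ++ w

listing : ∀ {r} → (G r → ℕ) → ∃ (Vec (G r))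
listing {r} c = cubeSum _++ᵛ_ r (λ g → c g , replicate (c g) g)

length-listing : ∀ {r} (c : G r → ℕ) → proj₁ (listing c) ≡ ℕΣ.∑ r c
length-listing {r} c = cubeSum-homo proj₁ (λ _ _ → refl) r _

count-listing : ∀ {r} (c : G r → ℕ) (x : G r) → count (_≟G x) (proj₂ (listing c)) ≡ c x
count-listing {r} c x = begin
  count (_≟G x) (proj₂ (listing c))
    ≡⟨ cubeSum-homo {_∙_ = _++ᵛ_} (count (_≟G x) ∘ proj₂) (λ a b → count-++ x (proj₂ a) (proj₂ b)) r _ ⟩
  ℕΣ.∑ r (λ g → count (_≟G x) (replicate (c g) g))
    ≡⟨ cubeSum-cong _+_ r (λ g → trans (count-replicate (c g) x g) (cong (if_then c g else 0) (≟G-sym g x))) ⟩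
  ℕΣ.∑ r (λ g → if does (x ≟G g) then c g else 0)
    ≡⟨ ℕΣ.∑-δ r x c ⟩
  c x ∎
  where open ≡-Reasoning

m+2^[2+j]≢2 : ∀ m j → m + 2 ^ (2 + j) ≢ 2
m+2^[2+j]≢2 m j eq with ≤-trans (^-monoʳ-≤ 2 {2} {2 + j} (s≤s (s≤s z≤n))) (subst (2 ^ (2 + j) ≤_) eq (m≤n+m _ m))
... | s≤s (s≤s ())

2^k≡2⇒k≡1 : ∀ k → 2 ^ k ≡ 2 → k ≡ 1
2^k≡2⇒k≡1 zero          ()
2^k≡2⇒k≡1 (suc zero)    _  = refl
2^k≡2⇒k≡1 (suc (suc j)) eq = ⊥-elim (m+2^[2+j]≢2 0 j eq)

m+2^k≡2⇒m≡1 : ∀ m k → k ≢ 1 → m + 2 ^ k ≡ 2 → m ≡ 1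
m+2^k≡2⇒m≡1 m zero          _   eq = suc-injective (trans (+-comm 1 m) eq)
m+2^k≡2⇒m≡1 m (suc zero)    k≢1 _  = ⊥-elim (k≢1 refl)
m+2^k≡2⇒m≡1 m (suc (suc j)) _   eq = ⊥-elim (m+2^[2+j]≢2 m j eq)

balance⇔ : ∀ {λ' n N P Q} h → λ' ≡ 2 * h → N + P ≡ Q → (λ' * Q ≡ 2 * n + λ' * P) ⇔ (n ≡ h * N)
balance⇔ {n = n} {N} {P} h refl refl = mk⇔
  (λ eq → sym (*-cancelˡ-≡ (h * N) n 2 (+-cancelʳ-≡ (2 * h * P) _ _ (trans (sym expand) eq))))
  (λ { refl → expand })
  where
  expand : 2 * h * (N + P) ≡ 2 * (h * N) + 2 * h * P
  expand = trans (*-distribˡ-+ (2 * h) N P) (cong (_+ 2 * h * P) (*-assoc 2 h N))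

∑-const-1 : ∀ k → ℕΣ.∑ k (λ _ → 1) ≡ 2 ^ k
∑-const-1 zero    = refl
∑-const-1 (suc k) = trans (cong₂ _+_ (∑-const-1 k) (∑-const-1 k)) (cong (2 ^ k +_) (sym (+-identityʳ _)))

module Subgroup {r₁ r} (E : Embedding r₁ r) where

  open Embedding E

  _∈J? : ∀ g → Dec (g ∈J E)
  g ∈J? = ∃?-cube r₁ (λ y → φ y ≟G g)

  φ-𝟘 : φ 𝟘 ≡ 𝟘
  φ-𝟘 = begin
    φ 𝟘         ≡⟨ cong φ (sym (⊕-self 𝟘)) ⟩
    φ (𝟘 ⊕ 𝟘)   ≡⟨ hom 𝟘 𝟘 ⟩
    φ 𝟘 ⊕ φ 𝟘   ≡⟨ ⊕-self _ ⟩
    𝟘           ∎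
    where open ≡-Reasoning

  module _ {M : Set} {_∙_ : Op₂ M} {ε : M} (isCM : IsCommutativeMonoid _≡_ _∙_ ε) where

    open CubeSum isCM

    ∑-fibre : ∀ g (a : M) → ∑ r₁ (λ y → if does (φ y ≟G g) then a else ε) ≡ (if does (g ∈J?) then a else ε)
    ∑-fibre g a with g ∈J?
    ... | yes (y₀ , refl) =
      trans (cubeSum-cong _∙_ r₁ (λ y → cong (if_then a else ε) (≟G-injective-sym inj y y₀)))
            (∑-δ r₁ y₀ (λ _ → a))
    ... | no g∉J = trans (cubeSum-cong _∙_ r₁ outside) (∑-ε r₁)
      where
      outside : ∀ y → (if does (φ y ≟G g) then a else ε) ≡ ε
      outside y with φ y ≟G g
      ... | yes φy≡g = ⊥-elim (g∉J (y , φy≡g))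
      ... | no _     = refl

    ∑-image : ∀ F → ∑ r₁ (F ∘ φ) ≡ ∑ r (λ g → if does (g ∈J?) then F g else ε)
    ∑-image F = begin
      ∑ r₁ (F ∘ φ)
        ≡⟨ cubeSum-cong _∙_ r₁ (λ y → sym (∑-δ r (φ y) F)) ⟩
      ∑ r₁ (λ y → ∑ r (λ g → if does (φ y ≟G g) then F g else ε))
        ≡⟨ ∑-swap r₁ r _ ⟩
      ∑ r (λ g → ∑ r₁ (λ y → if does (φ y ≟G g) then F g else ε))
        ≡⟨ cubeSum-cong _∙_ r (λ g → ∑-fibre g (F g)) ⟩
      ∑ r (λ g → if does (g ∈J?) then F g else ε) ∎
      where open ≡-Reasoning

    ∑-split : ∀ F → ∑ r (λ g → if does (g ∈J?) then ε else F g) ∙ ∑ r₁ (F ∘ φ) ≡ ∑ r F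
    ∑-split F = begin
      ∑ r (λ g → if does (g ∈J?) then ε else F g) ∙ ∑ r₁ (F ∘ φ)
        ≡⟨ cong (∑ r (λ g → if does (g ∈J?) then ε else F g) ∙_) (∑-image F) ⟩
      ∑ r (λ g → if does (g ∈J?) then ε else F g) ∙ ∑ r (λ g → if does (g ∈J?) then F g else ε)
        ≡⟨ sym (∑-∙ r _ _) ⟩
      ∑ r (λ g → (if does (g ∈J?) then ε else F g) ∙ (if does (g ∈J?) then F g else ε))
        ≡⟨ cubeSum-cong _∙_ r recombine ⟩
      ∑ r F ∎
      where
      open ≡-Reasoning
      recombine : ∀ g → (if does (g ∈J?) then ε else F g) ∙ (if does (g ∈J?) then F g else ε) ≡ F g
      recombine g with does (g ∈J?)
      ... | true  = identityˡ _
      ... | false = identityʳ _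

  outsideJ : ℕ → G r → ℕ
  outsideJ h g = if does (g ∈J?) then 0 else h

  outsideJ-∈ : ∀ {g} h → g ∈J E → outsideJ h g ≡ 0
  outsideJ-∈ {g} h g∈J with g ∈J?
  ... | yes _   = refl
  ... | no g∉J  = ⊥-elim (g∉J g∈J)

  outsideJ-∉ : ∀ {g} h → ¬ g ∈J E → outsideJ h g ≡ h
  outsideJ-∉ {g} h g∉J with g ∈J?
  ... | yes g∈J = ⊥-elim (g∉J g∈J)
  ... | no _    = refl

  N : ℕ
  N = ℕΣ.∑ r (outsideJ 1)

  T : G r
  T = GΣ.∑ r (λ g → if does (g ∈J?) then 𝟘 else g)

  N+2^r₁≡2^r : N + 2 ^ r₁ ≡ 2 ^ r
  N+2^r₁≡2^r = begin
    N + 2 ^ r₁               ≡⟨ cong (N +_) (sym (∑-const-1 r₁)) ⟩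
    N + ℕΣ.∑ r₁ (λ _ → 1)    ≡⟨ ∑-split +-0-isCommutativeMonoid (λ _ → 1) ⟩
    ℕΣ.∑ r (λ _ → 1)         ≡⟨ ∑-const-1 r ⟩
    2 ^ r                    ∎
    where open ≡-Reasoning

  N≡2^r∸2^r₁ : N ≡ 2 ^ r ∸ 2 ^ r₁
  N≡2^r∸2^r₁ = trans (sym (m+n∸n≡m N (2 ^ r₁))) (cong (_∸ 2 ^ r₁) N+2^r₁≡2^r)

  T≡ΣZ₂⊕φΣZ₂ : T ≡ ΣZ₂ r ⊕ φ (ΣZ₂ r₁)
  T≡ΣZ₂⊕φΣZ₂ = ⊕-move T _ _
    (trans (cong (T ⊕_) (cubeSum-homo φ hom r₁ id)) (∑-split (⊕-isCommutativeMonoid r) id))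

  ∑-outsideJ : ∀ h → ℕΣ.∑ r (outsideJ h) ≡ h * N
  ∑-outsideJ h = sym (trans (cubeSum-homo (h *_) (*-distribˡ-+ h) r _) (cubeSum-cong _+_ r scale))
    where
    scale : ∀ g → h * (if does (g ∈J?) then 0 else 1) ≡ (if does (g ∈J?) then 0 else h)
    scale g with does (g ∈J?)
    ... | true  = *-zeroʳ h
    ... | false = *-identityʳ h

  ∑-outsideJ-· : ∀ h → GΣ.∑ r (λ g → outsideJ h g · g) ≡ h · T
  ∑-outsideJ-· h = sym (trans (cubeSum-homo (h ·_) (λ x y → GΣ.·-distrib-∙ x y h) r _) (cubeSum-cong _⊕_ r scale))
    where
    scale : ∀ g → h · (if does (g ∈J?) then 𝟘 else g) ≡ (if does (g ∈J?) then 0 else h) · g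
    scale g with does (g ∈J?)
    ... | true  = GΣ.·-ε h
    ... | false = refl

  UniformOutsideJ : ℕ → ℕ → Set
  UniformOutsideJ λ' n = ∃ λ h → λ' ≡ 2 * h × n ≡ h * N × h · T ≢ 𝟘

  NH1⇒uniform : ∀ {λ' n} → Proper E → NH1 λ' E n → UniformOutsideJ λ' n
  NH1⇒uniform {λ'} {n} (g₀ , g₀∉J) nh = h , λ'≡2h , n≡hN , rowNZ ∘ trans rowSum≡h·T
    where
    open NH1 nh
    c : G r → ℕ
    c g = count (_≟G g) row
    h : ℕ
    h = c g₀
    λ'≡2h : λ' ≡ 2 * h
    λ'≡2h = trans (sym (multOut g₀ g₀∉J)) (mult≡2*count g₀ row)
    c≡outsideJ : ∀ g → c g ≡ outsideJ h g
    c≡outsideJ g with g ∈J?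
    ... | yes g∈J = *-cancelˡ-≡ _ 0 2 (trans (sym (mult≡2*count g row)) (multJ g g∈J))
    ... | no g∉J  = *-cancelˡ-≡ _ h 2 (trans (sym (mult≡2*count g row)) (trans (multOut g g∉J) λ'≡2h))
    n≡hN : n ≡ h * N
    n≡hN = trans (length-∑-count row) (trans (cubeSum-cong _+_ r c≡outsideJ) (∑-outsideJ h))
    rowSum≡h·T : rowSum row ≡ h · T
    rowSum≡h·T = trans (rowSum-∑-count row)
      (trans (cubeSum-cong _⊕_ r (λ g → cong (_· g) (c≡outsideJ g))) (∑-outsideJ-· h))

  uniform⇒NH1 : ∀ {λ' n} → UniformOutsideJ λ' n → NH1 λ' E n
  uniform⇒NH1 {λ'} {n} (h , λ'≡2h , n≡hN , h·T≢𝟘) = subst (NH1 λ' E) length≡n (record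
    { row     = row
    ; multJ   = λ g g∈J → trans (mult-row g) (cong (2 *_) (outsideJ-∈ h g∈J))
    ; multOut = λ g g∉J → trans (mult-row g) (trans (cong (2 *_) (outsideJ-∉ h g∉J)) (sym λ'≡2h))
    ; rowNZ   = h·T≢𝟘 ∘ trans (sym rowSum≡h·T)
    ; colNZ   = λ i row[i]≡𝟘 →
                  lookup-count≢0 row i (trans (cong (λ x → count (_≟G x) row) row[i]≡𝟘) count-𝟘)
    })
    where
    row : Vec (G r) (proj₁ (listing (outsideJ h)))
    row = proj₂ (listing (outsideJ h))
    count-row : ∀ g → count (_≟G g) row ≡ outsideJ h g
    count-row = count-listing (outsideJ h)
    mult-row : ∀ g → mult g row ≡ 2 * outsideJ h g
    mult-row g = trans (mult≡2*count g row) (cong (2 *_) (count-row g))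
    count-𝟘 : count (_≟G 𝟘) row ≡ 0
    count-𝟘 = trans (count-row 𝟘) (outsideJ-∈ h (𝟘 , φ-𝟘))
    length≡n : proj₁ (listing (outsideJ h)) ≡ n
    length≡n = trans (length-listing (outsideJ h)) (trans (∑-outsideJ h) (sym n≡hN))
    rowSum≡h·T : rowSum row ≡ h · T
    rowSum≡h·T = trans (rowSum-∑-count row)
      (trans (cubeSum-cong _⊕_ r (λ g → cong (_· g) (count-row g))) (∑-outsideJ-· h))

  r≡1⇒r₁≢1 : N ≢ 0 → r ≡ 1 → r₁ ≢ 1
  r≡1⇒r₁≢1 N≢0 r≡1 r₁≡1 =
    N≢0 (+-cancelʳ-≡ 2 N 0 (trans (cong (λ k → N + 2 ^ k) (sym r₁≡1)) (trans N+2^r₁≡2^r (cong (2 ^_) r≡1))))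

  N≡1 : r ≡ 1 → r₁ ≢ 1 → N ≡ 1
  N≡1 r≡1 r₁≢1 = m+2^k≡2⇒m≡1 N r₁ r₁≢1 (trans N+2^r₁≡2^r (cong (2 ^_) r≡1))

  φΣZ₂≡𝟘 : r₁ ≢ 1 → φ (ΣZ₂ r₁) ≡ 𝟘
  φΣZ₂≡𝟘 r₁≢1 = trans (cong φ (ΣZ₂-≢1 r₁ r₁≢1)) φ-𝟘

  T≡𝟘 : r ≢ 1 → r₁ ≢ 1 → T ≡ 𝟘
  T≡𝟘 r≢1 r₁≢1 = trans T≡ΣZ₂⊕φΣZ₂ (trans (cong₂ _⊕_ (ΣZ₂-≢1 r r≢1) (φΣZ₂≡𝟘 r₁≢1)) (⊕-self 𝟘))

  T≢𝟘 : N ≢ 0 → r ≡ 1 ⊎ r₁ ≡ 1 → T ≢ 𝟘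
  T≢𝟘 N≢0 (inj₁ r≡1) T≡𝟘 = ΣZ₂1≢𝟘 (subst (λ k → ΣZ₂ k ≡ 𝟘) r≡1 (begin
    ΣZ₂ r                  ≡⟨ sym (GΣ.identityʳ _) ⟩
    ΣZ₂ r ⊕ 𝟘              ≡⟨ cong (ΣZ₂ r ⊕_) (sym (φΣZ₂≡𝟘 r₁≢1)) ⟩
    ΣZ₂ r ⊕ φ (ΣZ₂ r₁)     ≡⟨ sym T≡ΣZ₂⊕φΣZ₂ ⟩
    T                      ≡⟨ T≡𝟘 ⟩
    𝟘                      ∎))
    where
    open ≡-Reasoning
    r₁≢1 : r₁ ≢ 1
    r₁≢1 = r≡1⇒r₁≢1 N≢0 r≡1
  T≢𝟘 N≢0 (inj₂ r₁≡1) T≡𝟘 = ΣZ₂1≢𝟘 (subst (λ k → ΣZ₂ k ≡ 𝟘) r₁≡1 (inj (begin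
    φ (ΣZ₂ r₁)             ≡⟨ sym (GΣ.identityˡ _) ⟩
    𝟘 ⊕ φ (ΣZ₂ r₁)         ≡⟨ cong (_⊕ φ (ΣZ₂ r₁)) (sym (ΣZ₂-≢1 r r≢1)) ⟩
    ΣZ₂ r ⊕ φ (ΣZ₂ r₁)     ≡⟨ sym T≡ΣZ₂⊕φΣZ₂ ⟩
    T                      ≡⟨ T≡𝟘 ⟩
    𝟘                      ≡⟨ sym φ-𝟘 ⟩
    φ 𝟘                    ∎)))
    where
    open ≡-Reasoning
    r≢1 : r ≢ 1
    r≢1 r≡1 = r≡1⇒r₁≢1 N≢0 r≡1 r₁≡1

  OddnessCondition : ℕ → Set
  OddnessCondition n = (2 ^ r₁ ≡ 2 × ∃ λ k → n ≡ (2 * k + 1) * (2 ^ r ∸ 2 ^ r₁)) ⊎ (2 ^ r ≡ 2 × Odd n)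

  odd×T≢𝟘⇔ : ∀ {h n} → n ≢ 0 → n ≡ h * N → (Odd h × T ≢ 𝟘) ⇔ OddnessCondition n
  odd×T≢𝟘⇔ {h} {n} n≢0 n≡hN = mk⇔ to from
    where
    N≢0 : N ≢ 0
    N≢0 N≡0 = n≢0 (trans n≡hN (trans (cong (h *_) N≡0) (*-zeroʳ h)))

    to : Odd h × T ≢ 𝟘 → OddnessCondition n
    to ((k , h≡2k+1) , T≢𝟘) with r₁ ≟ 1 | r ≟ 1
    ... | yes r₁≡1 | _       = inj₁ (cong (2 ^_) r₁≡1 , k , trans n≡hN (cong₂ _*_ h≡2k+1 N≡2^r∸2^r₁))
    ... | no r₁≢1  | yes r≡1 =
      inj₂ (cong (2 ^_) r≡1 , k , trans n≡hN (trans (cong (h *_) (N≡1 r≡1 r₁≢1)) (trans (*-identityʳ h) h≡2k+1)))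
    ... | no r₁≢1  | no r≢1  = ⊥-elim (T≢𝟘 (T≡𝟘 r≢1 r₁≢1))

    from : OddnessCondition n → Odd h × T ≢ 𝟘
    from (inj₁ (2^r₁≡2 , k , n≡[2k+1]N)) = (k , h≡2k+1) , T≢𝟘 N≢0 (inj₂ (2^k≡2⇒k≡1 r₁ 2^r₁≡2))
      where
      h≡2k+1 : h ≡ 2 * k + 1
      h≡2k+1 = *-cancelʳ-≡ h _ N {{≢-nonZero N≢0}}
        (trans (sym n≡hN) (trans n≡[2k+1]N (cong ((2 * k + 1) *_) (sym N≡2^r∸2^r₁))))
    from (inj₂ (2^r≡2 , k , n≡2k+1)) = (k , h≡2k+1) , T≢𝟘 N≢0 (inj₁ r≡1)
      where
      r≡1 : r ≡ 1
      r≡1 = 2^k≡2⇒k≡1 r 2^r≡2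
      h≡2k+1 : h ≡ 2 * k + 1
      h≡2k+1 = begin
        h      ≡⟨ sym (*-identityʳ h) ⟩
        h * 1  ≡⟨ cong (h *_) (sym (N≡1 r≡1 (r≡1⇒r₁≢1 N≢0 r≡1))) ⟩
        h * N  ≡⟨ sym n≡hN ⟩
        n      ≡⟨ n≡2k+1 ⟩
        2 * k + 1 ∎
        where open ≡-Reasoning

theorem2p3 : (r r₁ : ℕ) (E : Embedding r₁ r) → Proper E →
    (λ' n : ℕ) → NonZero λ' → NonZero n →
    NH1 λ' E n ⇔
    ((λ' * 2 ^ r ≡ 2 * n + λ' * 2 ^ r₁)
    × (2 ∣ λ')
    × ((2 ^ r₁ ≡ 2 × ∃ λ k → n ≡ (2 * k + 1) * (2 ^ r ∸ 2 ^ r₁))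
    ⊎ (2 ^ r ≡ 2 × ∃ λ k → n ≡ 2 * k + 1)))
theorem2p3 r r₁ E proper λ' n _ n≢0 = mk⇔
  (λ nh → let (h , λ'≡2h , n≡hN , h·T≢𝟘) = NH1⇒uniform proper nh in
    Equivalence.from (balance⇔ h λ'≡2h N+2^r₁≡2^r) n≡hN ,
    divides h (trans λ'≡2h (*-comm 2 h)) ,
    Equivalence.to (odd×T≢𝟘⇔ n≢0' n≡hN) (Equivalence.to (·-≢𝟘⇔ h T) h·T≢𝟘))
  (λ (balanced , divides h λ'≡h*2 , cases) →
    let λ'≡2h = trans λ'≡h*2 (*-comm h 2)
        n≡hN  = Equivalence.to (balance⇔ h λ'≡2h N+2^r₁≡2^r) balanced
        h·T≢𝟘 = Equivalence.from (·-≢𝟘⇔ h T) (Equivalence.from (odd×T≢𝟘⇔ n≢0' n≡hN) cases)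
    in uniform⇒NH1 (h , λ'≡2h , n≡hN , h·T≢𝟘))
  where
  open Subgroup E
  n≢0' : n ≢ 0
  n≢0' = ≢-nonZero⁻¹ n {{n≢0}}
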